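{- Let $m > 1$ be an integer. Then the infinite product $\prod_{k \geqslant 1} \prod_{j = 0}^{2^m - 1} (k + j)^{p (j)}$ converges and \[ \prod_{k \geqslant 1} \prod_{j = 0}^{2^m - 1} (k + j)^{p (j)} = \prod_{j = 0}^{2^{m - 1} - 1} (2 j + 1)^{p (j)} . \]
   Context: The Thue--Morse sequence $(t_j)_{j \geqslant 0}$ is defined by $t_j = 1$ if the number of ones in the binary representation of $j$ is odd, and $t_j = 0$ otherwise. Set $p (j) = (- 1)^{t_j}$. An infinite product $\prod_{k\ge1} a(k)$ is said to converge if its sequence of partial products converges to a nonzero limit. -}

module Defs where

open import Data.Bool using (Bool; true; false; if_then_else_)
open import Data.Nat as ℕ using (ℕ; zero; suc; _%_; _/_)
open import Data.Nat.Base using () renaming (_+_ to _+ℕ_; _*_ to _*ℕ_)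
open import Data.Integer using (ℤ; +_; -[1+_])
open import Data.Rational using (ℚ; 0ℚ; 1ℚ; _*_) renaming (_/_ to _÷_)

-- Number of ones in the binary representation of n (with fuel f ≥ number of bits).
onesAux : ℕ → ℕ → ℕ
onesAux zero    n = 0
onesAux (suc f) n = (n % 2) +ℕ onesAux f (n / 2)

ones : ℕ → ℕ
ones n = onesAux n n

odd : ℕ → Bool
odd zero          = false
odd (suc zero)    = true
odd (suc (suc n)) = odd n

t : ℕ → Bool
t j = odd (ones j)

p : ℕ → ℤ
p j = if t j then -[1+ 0 ] else + 1

-- n ^ p(j) as a rational: n if p(j) = 1, 1/n if p(j) = -1.
-- (Only used with n ≥ 1; the value at n = 0 is an irrelevant convention.)
powP : ℕ → ℕ → ℚ
powP zero    j = 0ℚ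
powP (suc n) j = if t j then (+ 1) ÷ suc n else (+ suc n) ÷ 1

prodBelow : ℕ → (ℕ → ℚ) → ℚ
prodBelow zero    f = 1ℚ
prodBelow (suc n) f = prodBelow n f * f n

inner : ℕ → ℕ → ℚ
inner m k = prodBelow (2 ℕ.^ m) (λ j → powP (k +ℕ j) j)

partial : ℕ → ℕ → ℚ
partial m n = prodBelow n (λ i → inner m (suc i))

rhs : ℕ → ℚ
rhs m = prodBelow (2 ℕ.^ (m ℕ.∸ 1)) (λ j → powP (2 *ℕ j +ℕ 1) j)

-- Since p(2i) = p(i) and p(2i+1) = -p(i), grouping j = 2i, 2i+1 turns the inner factor into
-- ∏_i (k+2i)^p(i) (k+2i+1)^-p(i), which telescopes in k: the n-th partial product is the
-- right-hand side times the remainder ∏_{i<2^(m-1)} (n+1+2i)^-p(i). Pairing once more (here m > 1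
-- is needed) makes the remainder a product of 2^(m-2) ratios (y/(y+2))^±1 with y = n+1+4l; each
-- lies between y/(y+4) and (y+4)/y, and these bounds telescope, so the remainder lies between
-- x/(x+2^m) and (x+2^m)/x for x = n+1. Every quantity is a fraction of natural numbers, so the
-- estimates are carried out by cross-multiplication in ℕ.
module Submission where

open import Defs
open import Data.Bool using (Bool; true; false; not)
open import Data.Bool.Properties using (not-involutive)
open import Data.Nat as ℕ using (ℕ; zero; suc; z≤n; s≤s; _≤_; _%_; _/_) renaming (_<_ to _<ℕ_)
import Data.Nat.Properties as ℕP
open import Data.Nat.DivMod using (m/n<m; m*n%n≡0; [m+kn]%n≡m%n; +-distrib-/-∣ʳ; m*n/n≡m)
open import Data.Nat.Divisibility using (divides-refl)
open import Data.Nat.Tactic.RingSolver using (solve-∀)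
open import Data.Integer as ℤ using (+_)
import Data.Integer.Properties as ℤP
open import Data.Rational as ℚ using (ℚ; 0ℚ; 1ℚ; _<_; _-_; ∣_∣; _*_; _+_; toℚᵘ)
open import Data.Rational.Solver using (module +-*-Solver)
open import Data.Rational.Unnormalised as ℚᵘ using (mkℚᵘ; *≡*; *<*) renaming (_≃_ to _≃ᵘ_)
import Data.Rational.Unnormalised.Properties as ℚᵘP
import Data.Rational.Properties as ℚP
open import Algebra.Bundles using (CommutativeMonoid)
open import Algebra.Properties.CommutativeSemigroup (CommutativeMonoid.commutativeSemigroup ℚP.*-1-commutativeMonoid) using (interchange)
open import Data.Product using (_×_; _,_; ∃-syntax)
open import Data.Sum using (inj₁; inj₂)
open import Function using (_∘_)
open import Relation.Binary.PropositionalEquality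

onesAux-zero : ∀ f → onesAux f 0 ≡ 0
onesAux-zero zero    = refl
onesAux-zero (suc f) = onesAux-zero f

n≤1+f⇒n/2≤f : ∀ n f → n ≤ suc f → n / 2 ≤ f
n≤1+f⇒n/2≤f zero    f _    = z≤n
n≤1+f⇒n/2≤f (suc n) f n≤f+1 = ℕP.≤-pred (ℕP.≤-trans (m/n<m (suc n) 2 (s≤s (s≤s z≤n))) n≤f+1)

onesAux-fuel : ∀ f g n → n ≤ f → n ≤ g → onesAux f n ≡ onesAux g n
onesAux-fuel zero    zero    n       _   _   = refl
onesAux-fuel zero    (suc g) .0      z≤n _   = sym (onesAux-zero (suc g))
onesAux-fuel (suc f) zero    .0      _   z≤n = onesAux-zero (suc f)
onesAux-fuel (suc f) (suc g) n       n≤f n≤g =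
  cong (n % 2 ℕ.+_) (onesAux-fuel f g (n / 2) (n≤1+f⇒n/2≤f n f n≤f) (n≤1+f⇒n/2≤f n g n≤g))

ones-step : ∀ n → ones n ≡ n % 2 ℕ.+ ones (n / 2)
ones-step zero    = refl
ones-step (suc n) = cong (suc n % 2 ℕ.+_)
  (onesAux-fuel n (suc n / 2) (suc n / 2) (n≤1+f⇒n/2≤f (suc n) n ℕP.≤-refl) ℕP.≤-refl)

ones-double : ∀ j → ones (2 ℕ.* j) ≡ ones j
ones-double j rewrite ℕP.*-comm 2 j =
  trans (ones-step (j ℕ.* 2)) (cong₂ (λ r q → r ℕ.+ ones q) (m*n%n≡0 j 2) (m*n/n≡m j 2))

ones-suc-double : ∀ j → ones (suc (2 ℕ.* j)) ≡ suc (ones j)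
ones-suc-double j rewrite ℕP.*-comm 2 j =
  trans (ones-step (1 ℕ.+ j ℕ.* 2))
        (cong₂ (λ r q → r ℕ.+ ones q) ([m+kn]%n≡m%n 1 j 2)
               (trans (+-distrib-/-∣ʳ 1 {d = 2} (divides-refl j)) (m*n/n≡m j 2)))

odd-suc : ∀ n → odd (suc n) ≡ not (odd n)
odd-suc zero          = refl
odd-suc (suc zero)    = refl
odd-suc (suc (suc n)) = odd-suc n

t-double : ∀ j → t (2 ℕ.* j) ≡ t j
t-double j = cong odd (ones-double j)

t-suc-double : ∀ j → t (suc (2 ℕ.* j)) ≡ not (t j)
t-suc-double j = trans (cong odd (ones-suc-double j)) (odd-suc (ones j))

prodBelow-cong : ∀ n {f g : ℕ → ℚ} → (∀ j → f j ≡ g j) → prodBelow n f ≡ prodBelow n g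
prodBelow-cong zero    f≗g = refl
prodBelow-cong (suc n) f≗g = cong₂ _*_ (prodBelow-cong n f≗g) (f≗g n)

prodBelow-one : ∀ n → prodBelow n (λ _ → 1ℚ) ≡ 1ℚ
prodBelow-one zero    = refl
prodBelow-one (suc n) = trans (ℚP.*-identityʳ _) (prodBelow-one n)

prodBelow-* : ∀ n (f g : ℕ → ℚ) → prodBelow n (λ j → f j * g j) ≡ prodBelow n f * prodBelow n g
prodBelow-* zero    f g = refl
prodBelow-* (suc n) f g =
  trans (cong (_* (f n * g n)) (prodBelow-* n f g)) (interchange (prodBelow n f) (prodBelow n g) (f n) (g n))

prodBelow-swap : ∀ n M (g : ℕ → ℕ → ℚ) →
  prodBelow n (λ i → prodBelow M (g i)) ≡ prodBelow M (λ j → prodBelow n (λ i → g i j))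
prodBelow-swap zero    M g = sym (prodBelow-one M)
prodBelow-swap (suc n) M g =
  trans (cong (_* prodBelow M (g n)) (prodBelow-swap n M g))
        (sym (prodBelow-* M (λ j → prodBelow n (λ i → g i j)) (g n)))

prodBelow-pairs : ∀ M (f : ℕ → ℚ) →
  prodBelow (2 ℕ.* M) f ≡ prodBelow M (λ j → f (2 ℕ.* j) * f (suc (2 ℕ.* j)))
prodBelow-pairs zero    f = refl
prodBelow-pairs (suc M) f = begin
  prodBelow (2 ℕ.* suc M) f                 ≡⟨ cong (λ k → prodBelow k f) (ℕP.*-suc 2 M) ⟩
  (prodBelow (2 ℕ.* M) f * f₀) * f₁         ≡⟨ ℚP.*-assoc (prodBelow (2 ℕ.* M) f) f₀ f₁ ⟩
  prodBelow (2 ℕ.* M) f * (f₀ * f₁)         ≡⟨ cong (_* (f₀ * f₁)) (prodBelow-pairs M f) ⟩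
  prodBelow M (λ j → f (2 ℕ.* j) * f (suc (2 ℕ.* j))) * (f₀ * f₁) ∎
  where
  open ≡-Reasoning
  f₀ f₁ : ℚ
  f₀ = f (2 ℕ.* M)
  f₁ = f (suc (2 ℕ.* M))

prodBelow-telescope : ∀ (u v : ℕ → ℚ) → (∀ i → v i * u i ≡ 1ℚ) →
  ∀ n → prodBelow n (λ i → u i * v (suc i)) ≡ u 0 * v n
prodBelow-telescope u v vu≡1 zero    = sym (trans (ℚP.*-comm (u 0) (v 0)) (vu≡1 0))
prodBelow-telescope u v vu≡1 (suc n) = begin
  prodBelow n (λ i → u i * v (suc i)) * (u n * v (suc n)) ≡⟨ cong (_* (u n * v (suc n))) (prodBelow-telescope u v vu≡1 n) ⟩
  (u 0 * v n) * (u n * v (suc n))                         ≡⟨ ℚP.*-assoc (u 0) (v n) _ ⟩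
  u 0 * (v n * (u n * v (suc n)))                         ≡⟨ cong (u 0 *_) (sym (ℚP.*-assoc (v n) (u n) _)) ⟩
  u 0 * ((v n * u n) * v (suc n))                         ≡⟨ cong (λ q → u 0 * (q * v (suc n))) (vu≡1 n) ⟩
  u 0 * (1ℚ * v (suc n))                                  ≡⟨ cong (u 0 *_) (ℚP.*-identityˡ _) ⟩
  u 0 * v (suc n)                                         ∎
  where open ≡-Reasoning

*-pos : ∀ {a b} → 0 <ℕ a → 0 <ℕ b → 0 <ℕ a ℕ.* b
*-pos {suc a} {suc b} _ _ = s≤s z≤n

prodℕ : ℕ → (ℕ → ℕ) → ℕ
prodℕ zero    f = 1
prodℕ (suc n) f = prodℕ n f ℕ.* f n

prodℕ-pos : ∀ n (f : ℕ → ℕ) → (∀ j → 0 <ℕ f j) → 0 <ℕ prodℕ n f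
prodℕ-pos zero    f f>0 = s≤s z≤n
prodℕ-pos (suc n) f f>0 = *-pos (prodℕ-pos n f f>0) (f>0 n)

-- The value at denominator 0 is junk; every lemma assumes positive denominators.
frac : ℕ → ℕ → ℚ
frac a zero    = 0ℚ
frac a (suc b) = + a ℚ./ suc b

toℚᵘ-frac : ∀ a b → toℚᵘ (frac a (suc b)) ≃ᵘ mkℚᵘ (+ a) b
toℚᵘ-frac a b = ℚP.toℚᵘ-fromℚᵘ (mkℚᵘ (+ a) b)

frac-cong : ∀ {a b c d} → 0 <ℕ b → 0 <ℕ d → a ℕ.* d ≡ c ℕ.* b → frac a b ≡ frac c d
frac-cong {a} {suc b} {c} {suc d} _ _ ad≡cb = ℚP.toℚᵘ-injective (begin-equality
  toℚᵘ (frac a (suc b)) ≃⟨ toℚᵘ-frac a b ⟩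
  mkℚᵘ (+ a) b          ≃⟨ *≡* (trans (sym (ℤP.pos-* a (suc d))) (trans (cong +_ ad≡cb) (ℤP.pos-* c (suc b)))) ⟩
  mkℚᵘ (+ c) d          ≃⟨ ℚᵘP.≃-sym (toℚᵘ-frac c d) ⟩
  toℚᵘ (frac c (suc d)) ∎)
  where open ℚᵘP.≤-Reasoning

frac-injective : ∀ {a b c d} → 0 <ℕ b → 0 <ℕ d → frac a b ≡ frac c d → a ℕ.* d ≡ c ℕ.* b
frac-injective {a} {suc b} {c} {suc d} _ _ eq
  with ℚᵘP.≃-trans (ℚᵘP.≃-sym (toℚᵘ-frac a b)) (ℚᵘP.≃-trans (ℚP.toℚᵘ-cong eq) (toℚᵘ-frac c d))
... | *≡* ad≡cb = ℤP.+-injective (trans (ℤP.pos-* a (suc d)) (trans ad≡cb (sym (ℤP.pos-* c (suc b)))))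

frac-< : ∀ {a b c d} → 0 <ℕ b → 0 <ℕ d → a ℕ.* d <ℕ c ℕ.* b → frac a b < frac c d
frac-< {a} {suc b} {c} {suc d} _ _ ad<cb = ℚP.toℚᵘ-cancel-< (begin-strict
  toℚᵘ (frac a (suc b)) ≃⟨ toℚᵘ-frac a b ⟩
  mkℚᵘ (+ a) b          <⟨ *<* (subst₂ ℤ._<_ (ℤP.pos-* a (suc d)) (ℤP.pos-* c (suc b)) (ℤ.+<+ ad<cb)) ⟩
  mkℚᵘ (+ c) d          ≃⟨ ℚᵘP.≃-sym (toℚᵘ-frac c d) ⟩
  toℚᵘ (frac c (suc d)) ∎)
  where open ℚᵘP.≤-Reasoning

frac-* : ∀ {a b c d} → 0 <ℕ b → 0 <ℕ d → frac a b * frac c d ≡ frac (a ℕ.* c) (b ℕ.* d)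
frac-* {a} {suc b} {c} {suc d} _ _ = ℚP.toℚᵘ-injective (begin-equality
  toℚᵘ (frac a (suc b) * frac c (suc d))             ≃⟨ ℚP.toℚᵘ-homo-* (frac a (suc b)) (frac c (suc d)) ⟩
  toℚᵘ (frac a (suc b)) ℚᵘ.* toℚᵘ (frac c (suc d))   ≃⟨ ℚᵘP.*-cong (toℚᵘ-frac a b) (toℚᵘ-frac c d) ⟩
  mkℚᵘ (+ a ℤ.* + c) (ℕ.pred (suc b ℕ.* suc d))      ≃⟨ ℚᵘP.≃-reflexive (cong (λ n → mkℚᵘ n _) (sym (ℤP.pos-* a c))) ⟩
  mkℚᵘ (+ (a ℕ.* c)) (ℕ.pred (suc b ℕ.* suc d))      ≃⟨ ℚᵘP.≃-sym (toℚᵘ-frac (a ℕ.* c) _) ⟩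
  toℚᵘ (frac (a ℕ.* c) (suc b ℕ.* suc d))            ∎)
  where open ℚᵘP.≤-Reasoning

frac-+ : ∀ {a b c d} → 0 <ℕ b → 0 <ℕ d →
  frac a b + frac c d ≡ frac (a ℕ.* d ℕ.+ c ℕ.* b) (b ℕ.* d)
frac-+ {a} {suc b} {c} {suc d} _ _ = ℚP.toℚᵘ-injective (begin-equality
  toℚᵘ (frac a (suc b) + frac c (suc d))             ≃⟨ ℚP.toℚᵘ-homo-+ (frac a (suc b)) (frac c (suc d)) ⟩
  toℚᵘ (frac a (suc b)) ℚᵘ.+ toℚᵘ (frac c (suc d))   ≃⟨ ℚᵘP.+-cong (toℚᵘ-frac a b) (toℚᵘ-frac c d) ⟩
  mkℚᵘ (+ a ℤ.* + suc d ℤ.+ + c ℤ.* + suc b) _       ≃⟨ ℚᵘP.≃-reflexive (cong (λ n → mkℚᵘ n _) (cong₂ ℤ._+_ (sym (ℤP.pos-* a (suc d))) (sym (ℤP.pos-* c (suc b))))) ⟩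
  mkℚᵘ (+ (a ℕ.* suc d ℕ.+ c ℕ.* suc b)) _           ≃⟨ ℚᵘP.≃-sym (toℚᵘ-frac _ _) ⟩
  toℚᵘ (frac (a ℕ.* suc d ℕ.+ c ℕ.* suc b) (suc b ℕ.* suc d)) ∎)
  where open ℚᵘP.≤-Reasoning

frac-inverse : ∀ {a b} → 0 <ℕ a → 0 <ℕ b → frac a b * frac b a ≡ 1ℚ
frac-inverse {a} {b} 0<a 0<b =
  trans (frac-* 0<b 0<a) (frac-cong {c = 1} {d = 1} (*-pos 0<b 0<a) (s≤s z≤n) ab*1≡1*ba)
  where
  ab*1≡1*ba : a ℕ.* b ℕ.* 1 ≡ 1 ℕ.* (b ℕ.* a)
  ab*1≡1*ba = trans (ℕP.*-identityʳ _) (trans (ℕP.*-comm a b) (sym (ℕP.*-identityˡ _)))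

frac≢0 : ∀ {a b} → 0 <ℕ a → 0 <ℕ b → frac a b ≢ 0ℚ
frac≢0 {a} {b} a>0 b>0 eq = ℕP.<-irrefl (sym a*1≡0) (ℕP.<-≤-trans a>0 (ℕP.m≤m*n a 1))
  where
  a*1≡0 : a ℕ.* 1 ≡ 0
  a*1≡0 = frac-injective {a} {b} {0} {1} b>0 (s≤s z≤n) eq

positive⇒frac : ∀ {r} → 0ℚ < r → ∃[ e ] ∃[ d ] (r ≡ frac (suc e) (suc d))
positive⇒frac {ℚ.mkℚ ℤ.+[1+ e ] d _} _ = e , d , ℚP.toℚᵘ-injective (ℚᵘP.≃-sym (toℚᵘ-frac (suc e) d))
positive⇒frac {ℚ.mkℚ (+ zero)   d _} (ℚ.*<* (ℤ.+<+ ()))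
positive⇒frac {ℚ.mkℚ ℤ.-[1+ e ] d _} (ℚ.*<* ())

prodBelow-frac : ∀ n (u v : ℕ → ℕ) → (∀ j → 0 <ℕ v j) →
  prodBelow n (λ j → frac (u j) (v j)) ≡ frac (prodℕ n u) (prodℕ n v)
prodBelow-frac zero    u v v>0 = refl
prodBelow-frac (suc n) u v v>0 =
  trans (cong (_* frac (u n) (v n)) (prodBelow-frac n u v v>0)) (frac-* (prodℕ-pos n v v>0) (v>0 n))

p<q+r⇒p-q<r : ∀ {p q r} → p < q + r → p - q < r
p<q+r⇒p-q<r {p} {q} {r} p<q+r = subst (p - q <_) (q+r-q≡r q r) (ℚP.+-monoˡ-< (ℚ.- q) p<q+r)
  where
  open +-*-Solver
  q+r-q≡r : ∀ q r → (q + r) - q ≡ r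
  q+r-q≡r = solve 2 (λ q r → (q :+ r) :- q := r) refl

∣p-q∣<r : ∀ {p q r} → p < q + r → q < p + r → ∣ p - q ∣ < r
∣p-q∣<r {p} {q} {r} p<q+r q<p+r with ℚP.∣p∣≡p∨∣p∣≡-p (p - q)
... | inj₁ ∣p-q∣≡p-q    = subst (_< r) (sym ∣p-q∣≡p-q) (p<q+r⇒p-q<r p<q+r)
... | inj₂ ∣p-q∣≡-[p-q] = subst (_< r) (sym (trans ∣p-q∣≡-[p-q] (neg-sub p q))) (p<q+r⇒p-q<r q<p+r)
  where
  open +-*-Solver
  neg-sub : ∀ p q → ℚ.- (p - q) ≡ q - p
  neg-sub = solve 2 (λ p q → :- (p :- q) := q :- p) refl

prodℕ-ratio-bound : ∀ (u v y : ℕ → ℕ) → (∀ i → u i ℕ.* y i ≤ v i ℕ.* y (suc i)) →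
  ∀ k → prodℕ k u ℕ.* y 0 ≤ prodℕ k v ℕ.* y k
prodℕ-ratio-bound u v y step zero    = ℕP.≤-refl
prodℕ-ratio-bound u v y step (suc k) = begin
  prodℕ k u ℕ.* u k ℕ.* y 0       ≡⟨ swap (prodℕ k u) (u k) (y 0) ⟩
  prodℕ k u ℕ.* y 0 ℕ.* u k       ≤⟨ ℕP.*-monoˡ-≤ (u k) (prodℕ-ratio-bound u v y step k) ⟩
  prodℕ k v ℕ.* y k ℕ.* u k       ≡⟨ regroup (prodℕ k v) (y k) (u k) ⟩
  prodℕ k v ℕ.* (u k ℕ.* y k)     ≤⟨ ℕP.*-monoʳ-≤ (prodℕ k v) (step k) ⟩
  prodℕ k v ℕ.* (v k ℕ.* y (suc k)) ≡⟨ ℕP.*-assoc (prodℕ k v) (v k) (y (suc k)) ⟨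
  prodℕ k v ℕ.* v k ℕ.* y (suc k)   ∎
  where
  open ℕP.≤-Reasoning
  swap : ∀ p a b → p ℕ.* a ℕ.* b ≡ p ℕ.* b ℕ.* a
  swap = solve-∀
  regroup : ∀ p a b → p ℕ.* a ℕ.* b ≡ p ℕ.* (b ℕ.* a)
  regroup = solve-∀

ratio-close : ∀ c A B D x → A ℕ.* x ≤ B ℕ.* (D ℕ.+ x) → D ℕ.* c <ℕ x → 0 <ℕ B →
  c ℕ.* A <ℕ c ℕ.* B ℕ.+ B
ratio-close c A B D x Ax≤B[D+x] Dc<x B>0 = ℕP.*-cancelʳ-< x (c ℕ.* A) (c ℕ.* B ℕ.+ B) (begin-strict
  c ℕ.* A ℕ.* x                       ≡⟨ ℕP.*-assoc c A x ⟩
  c ℕ.* (A ℕ.* x)                     ≤⟨ ℕP.*-monoʳ-≤ c Ax≤B[D+x] ⟩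
  c ℕ.* (B ℕ.* (D ℕ.+ x))             ≡⟨ expand c B D x ⟩
  c ℕ.* B ℕ.* x ℕ.+ D ℕ.* c ℕ.* B     <⟨ ℕP.+-monoʳ-< (c ℕ.* B ℕ.* x) (ℕP.*-monoˡ-< B {{ℕ.>-nonZero B>0}} Dc<x) ⟩
  c ℕ.* B ℕ.* x ℕ.+ x ℕ.* B           ≡⟨ collect c B x ⟩
  (c ℕ.* B ℕ.+ B) ℕ.* x               ∎)
  where
  open ℕP.≤-Reasoning
  expand : ∀ c B D x → c ℕ.* (B ℕ.* (D ℕ.+ x)) ≡ c ℕ.* B ℕ.* x ℕ.+ D ℕ.* c ℕ.* B
  expand = solve-∀
  collect : ∀ c B x → c ℕ.* B ℕ.* x ℕ.+ x ℕ.* B ≡ (c ℕ.* B ℕ.+ B) ℕ.* x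
  collect = solve-∀

ratio-close-sym : ∀ c A B D x → B ℕ.* x ≤ A ℕ.* (D ℕ.+ x) → D ℕ.* c <ℕ x → 0 <ℕ A → 0 <ℕ B →
  c ℕ.* B <ℕ c ℕ.* A ℕ.+ B
ratio-close-sym c A B D x Bx≤A[D+x] Dc<x A>0 B>0 with ℕP.≤-total A B
... | inj₁ A≤B = ℕP.<-≤-trans (ratio-close c B A D x Bx≤A[D+x] Dc<x A>0) (ℕP.+-monoʳ-≤ (c ℕ.* A) A≤B)
... | inj₂ B≤A = ℕP.≤-<-trans (ℕP.*-monoʳ-≤ c B≤A) (ℕP.m<m+n (c ℕ.* A) B>0)

frac-close : ∀ {R S A B D x} e d → 0 <ℕ S → 0 <ℕ A → 0 <ℕ B →
  A ℕ.* x ≤ B ℕ.* (D ℕ.+ x) → B ℕ.* x ≤ A ℕ.* (D ℕ.+ x) → D ℕ.* (R ℕ.* suc d) <ℕ x →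
  ∣ frac (R ℕ.* A) (S ℕ.* B) - frac R S ∣ < frac (suc e) (suc d)
frac-close {R} {S} {A} {B} {D} {x} e d S>0 A>0 B>0 Ax≤B[D+x] Bx≤A[D+x] Dc<x = ∣p-q∣<r
  (subst (frac (R ℕ.* A) (S ℕ.* B) <_) (sym (frac-+ {R} {S} {suc e} {suc d} S>0 (s≤s z≤n)))
    (frac-< (*-pos S>0 B>0) (*-pos S>0 (s≤s z≤n)) upper))
  (subst (frac R S <_) (sym (frac-+ {R ℕ.* A} {S ℕ.* B} {suc e} {suc d} (*-pos S>0 B>0) (s≤s z≤n)))
    (frac-< S>0 (*-pos (*-pos S>0 B>0) (s≤s z≤n)) lower))
  where
  open ℕP.≤-Reasoning
  c E : ℕ
  c = R ℕ.* suc d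
  E = suc e ℕ.* S
  instance
    S≢0 : ℕ.NonZero S
    S≢0 = ℕ.>-nonZero S>0
    E≢0 : ℕ.NonZero E
    E≢0 = ℕ.>-nonZero (*-pos {suc e} (s≤s z≤n) S>0)
  B≤EB : B ≤ E ℕ.* B
  B≤EB = ℕP.m≤n*m B E
  upper-lhs : ∀ R A S d → R ℕ.* A ℕ.* (S ℕ.* d) ≡ S ℕ.* (R ℕ.* d ℕ.* A)
  upper-lhs = solve-∀
  upper-rhs : ∀ R S B d e → S ℕ.* (R ℕ.* d ℕ.* B ℕ.+ e ℕ.* S ℕ.* B) ≡ (R ℕ.* d ℕ.+ e ℕ.* S) ℕ.* (S ℕ.* B)
  upper-rhs = solve-∀
  lower-lhs : ∀ R S B d → R ℕ.* (S ℕ.* B ℕ.* d) ≡ S ℕ.* (R ℕ.* d ℕ.* B)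
  lower-lhs = solve-∀
  lower-rhs : ∀ R S A B d e → S ℕ.* (R ℕ.* d ℕ.* A ℕ.+ e ℕ.* S ℕ.* B) ≡ (R ℕ.* A ℕ.* d ℕ.+ e ℕ.* (S ℕ.* B)) ℕ.* S
  lower-rhs = solve-∀
  upper : R ℕ.* A ℕ.* (S ℕ.* suc d) <ℕ (R ℕ.* suc d ℕ.+ suc e ℕ.* S) ℕ.* (S ℕ.* B)
  upper = begin-strict
    R ℕ.* A ℕ.* (S ℕ.* suc d)  ≡⟨ upper-lhs R A S (suc d) ⟩
    S ℕ.* (c ℕ.* A)            <⟨ ℕP.*-monoʳ-< S (ratio-close c A B D x Ax≤B[D+x] Dc<x B>0) ⟩
    S ℕ.* (c ℕ.* B ℕ.+ B)      ≤⟨ ℕP.*-monoʳ-≤ S (ℕP.+-monoʳ-≤ (c ℕ.* B) B≤EB) ⟩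
    S ℕ.* (c ℕ.* B ℕ.+ E ℕ.* B) ≡⟨ upper-rhs R S B (suc d) (suc e) ⟩
    (R ℕ.* suc d ℕ.+ suc e ℕ.* S) ℕ.* (S ℕ.* B) ∎
  lower : R ℕ.* (S ℕ.* B ℕ.* suc d) <ℕ (R ℕ.* A ℕ.* suc d ℕ.+ suc e ℕ.* (S ℕ.* B)) ℕ.* S
  lower = begin-strict
    R ℕ.* (S ℕ.* B ℕ.* suc d)  ≡⟨ lower-lhs R S B (suc d) ⟩
    S ℕ.* (c ℕ.* B)            <⟨ ℕP.*-monoʳ-< S (ratio-close-sym c A B D x Bx≤A[D+x] Dc<x A>0 B>0) ⟩
    S ℕ.* (c ℕ.* A ℕ.+ B)      ≤⟨ ℕP.*-monoʳ-≤ S (ℕP.+-monoʳ-≤ (c ℕ.* A) B≤EB) ⟩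
    S ℕ.* (c ℕ.* A ℕ.+ E ℕ.* B) ≡⟨ lower-rhs R S A B (suc d) (suc e) ⟩
    (R ℕ.* A ℕ.* suc d ℕ.+ suc e ℕ.* (S ℕ.* B)) ℕ.* S ∎

-- signPow b a = a ^ (-1)^b
signNum : Bool → ℕ → ℕ
signNum true  a = 1
signNum false a = a

signPow : Bool → ℕ → ℚ
signPow b a = frac (signNum b a) (signNum (not b) a)

signNum-pos : ∀ b {a} → 0 <ℕ a → 0 <ℕ signNum b a
signNum-pos true  _   = s≤s z≤n
signNum-pos false a>0 = a>0

powP≡signPow : ∀ a j → powP (suc a) j ≡ signPow (t j) (suc a)
powP≡signPow a j with t j
... | true  = refl
... | false = refl

signPow-inverse : ∀ b a → signPow (not b) (suc a) * signPow b (suc a) ≡ 1ℚ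
signPow-inverse true  a = frac-inverse {suc a} {1} (s≤s z≤n) (s≤s z≤n)
signPow-inverse false a = frac-inverse {1} {suc a} (s≤s z≤n) (s≤s z≤n)

inner-pairs : ∀ M i →
  prodBelow (2 ℕ.* M) (λ j → powP (suc i ℕ.+ j) j) ≡
  prodBelow M (λ j → signPow (t j) (suc i ℕ.+ 2 ℕ.* j) * signPow (not (t j)) (suc (suc i) ℕ.+ 2 ℕ.* j))
inner-pairs M i = trans (prodBelow-pairs M (λ j → powP (suc i ℕ.+ j) j)) (prodBelow-cong M pair)
  where
  pair : ∀ j → powP (suc i ℕ.+ 2 ℕ.* j) (2 ℕ.* j) * powP (suc i ℕ.+ suc (2 ℕ.* j)) (suc (2 ℕ.* j)) ≡
               signPow (t j) (suc i ℕ.+ 2 ℕ.* j) * signPow (not (t j)) (suc (suc i) ℕ.+ 2 ℕ.* j)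
  pair j rewrite ℕP.+-suc i (2 ℕ.* j) = cong₂ _*_
    (trans (powP≡signPow (i ℕ.+ 2 ℕ.* j) (2 ℕ.* j)) (cong (λ b → signPow b (suc i ℕ.+ 2 ℕ.* j)) (t-double j)))
    (trans (powP≡signPow (suc i ℕ.+ 2 ℕ.* j) (suc (2 ℕ.* j))) (cong (λ b → signPow b (suc (suc i) ℕ.+ 2 ℕ.* j)) (t-suc-double j)))

remainder : ℕ → ℕ → ℚ
remainder M n = prodBelow M (λ j → signPow (not (t j)) (suc n ℕ.+ 2 ℕ.* j))

rhs≡prodBelow-signPow : ∀ k → rhs (2 ℕ.+ k) ≡ prodBelow (2 ℕ.^ suc k) (λ j → signPow (t j) (suc (2 ℕ.* j)))
rhs≡prodBelow-signPow k = prodBelow-cong (2 ℕ.^ suc k) λ j →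
  trans (cong (λ a → powP a j) (ℕP.+-comm (2 ℕ.* j) 1)) (powP≡signPow (2 ℕ.* j) j)

partial≡rhs*remainder : ∀ k n → partial (2 ℕ.+ k) n ≡ rhs (2 ℕ.+ k) * remainder (2 ℕ.^ suc k) n
partial≡rhs*remainder k n = begin
  prodBelow n (λ i → prodBelow (2 ℕ.* M) (λ j → powP (suc i ℕ.+ j) j)) ≡⟨ prodBelow-cong n (inner-pairs M) ⟩
  prodBelow n (λ i → prodBelow M (g i))                                ≡⟨ prodBelow-swap n M g ⟩
  prodBelow M (λ j → prodBelow n (λ i → g i j))                        ≡⟨ prodBelow-cong M telescope ⟩
  prodBelow M (λ j → signPow (t j) (suc (2 ℕ.* j)) * signPow (not (t j)) (suc n ℕ.+ 2 ℕ.* j))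
                                                                       ≡⟨ prodBelow-* M _ _ ⟩
  prodBelow M (λ j → signPow (t j) (suc (2 ℕ.* j))) * remainder M n   ≡⟨ cong (_* remainder M n) (rhs≡prodBelow-signPow k) ⟨
  rhs (2 ℕ.+ k) * remainder M n                                        ∎
  where
  open ≡-Reasoning
  M : ℕ
  M = 2 ℕ.^ suc k
  g : ℕ → ℕ → ℚ
  g i j = signPow (t j) (suc i ℕ.+ 2 ℕ.* j) * signPow (not (t j)) (suc (suc i) ℕ.+ 2 ℕ.* j)
  telescope : ∀ j → prodBelow n (λ i → g i j) ≡ signPow (t j) (suc (2 ℕ.* j)) * signPow (not (t j)) (suc n ℕ.+ 2 ℕ.* j)
  telescope j = prodBelow-telescope (λ i → signPow (t j) (suc i ℕ.+ 2 ℕ.* j)) (λ i → signPow (not (t j)) (suc i ℕ.+ 2 ℕ.* j))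
                  (λ i → signPow-inverse (t j) (i ℕ.+ 2 ℕ.* j)) n

rhsNum rhsDen : ℕ → ℕ
rhsNum M = prodℕ M (λ j → signNum (t j) (suc (2 ℕ.* j)))
rhsDen M = prodℕ M (λ j → signNum (not (t j)) (suc (2 ℕ.* j)))

rhsNum-pos : ∀ M → 0 <ℕ rhsNum M
rhsNum-pos M = prodℕ-pos M _ (λ j → signNum-pos (t j) (s≤s z≤n))

rhsDen-pos : ∀ M → 0 <ℕ rhsDen M
rhsDen-pos M = prodℕ-pos M _ (λ j → signNum-pos (not (t j)) (s≤s z≤n))

rhs≡frac : ∀ k → rhs (2 ℕ.+ k) ≡ frac (rhsNum (2 ℕ.^ suc k)) (rhsDen (2 ℕ.^ suc k))
rhs≡frac k = trans (rhs≡prodBelow-signPow k) (prodBelow-frac (2 ℕ.^ suc k) _ _ (λ j → signNum-pos (not (t j)) (s≤s z≤n)))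

pairNum pairDen : Bool → ℕ → ℕ
pairNum b y = signNum (not b) y ℕ.* signNum b (2 ℕ.+ y)
pairDen b y = signNum b y ℕ.* signNum (not b) (2 ℕ.+ y)

pairNum-pos : ∀ b {y} → 0 <ℕ y → 0 <ℕ pairNum b y
pairNum-pos b y>0 = *-pos (signNum-pos (not b) y>0) (signNum-pos b (s≤s z≤n))

pairDen-pos : ∀ b {y} → 0 <ℕ y → 0 <ℕ pairDen b y
pairDen-pos b y>0 = *-pos (signNum-pos b y>0) (signNum-pos (not b) (s≤s z≤n))

signPow-pair : ∀ b {y} → 0 <ℕ y → signPow (not b) y * signPow b (2 ℕ.+ y) ≡ frac (pairNum b y) (pairDen b y)
signPow-pair true  {y} _   = frac-* {y} {1} {1} {2 ℕ.+ y} (s≤s z≤n) (s≤s z≤n)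
signPow-pair false {y} y>0 = frac-* {1} {y} {2 ℕ.+ y} {1} y>0 (s≤s z≤n)

remNum remDen : ℕ → ℕ → ℕ
remNum K x = prodℕ K (λ i → pairNum (t i) (4 ℕ.* i ℕ.+ x))
remDen K x = prodℕ K (λ i → pairDen (t i) (4 ℕ.* i ℕ.+ x))

remNum-pos : ∀ K {x} → 0 <ℕ x → 0 <ℕ remNum K x
remNum-pos K {x} x>0 = prodℕ-pos K _ (λ i → pairNum-pos (t i) (ℕP.<-≤-trans x>0 (ℕP.m≤n+m x (4 ℕ.* i))))

remDen-pos : ∀ K {x} → 0 <ℕ x → 0 <ℕ remDen K x
remDen-pos K {x} x>0 = prodℕ-pos K _ (λ i → pairDen-pos (t i) (ℕP.<-≤-trans x>0 (ℕP.m≤n+m x (4 ℕ.* i))))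

remainder≡frac : ∀ K n → remainder (2 ℕ.* K) n ≡ frac (remNum K (suc n)) (remDen K (suc n))
remainder≡frac K n =
  trans (prodBelow-pairs K _)
        (trans (prodBelow-cong K pair) (prodBelow-frac K _ _ (λ i → pairDen-pos (t i) (y>0 i))))
  where
  y : ℕ → ℕ
  y i = 4 ℕ.* i ℕ.+ suc n
  y>0 : ∀ i → 0 <ℕ y i
  y>0 i = ℕP.<-≤-trans (s≤s z≤n) (ℕP.m≤n+m (suc n) (4 ℕ.* i))
  even-index : ∀ n i → suc n ℕ.+ 2 ℕ.* (2 ℕ.* i) ≡ 4 ℕ.* i ℕ.+ suc n
  even-index = solve-∀
  odd-index : ∀ n i → suc n ℕ.+ 2 ℕ.* suc (2 ℕ.* i) ≡ 2 ℕ.+ (4 ℕ.* i ℕ.+ suc n)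
  odd-index = solve-∀
  pair : ∀ i → signPow (not (t (2 ℕ.* i))) (suc n ℕ.+ 2 ℕ.* (2 ℕ.* i)) *
               signPow (not (t (suc (2 ℕ.* i)))) (suc n ℕ.+ 2 ℕ.* suc (2 ℕ.* i)) ≡
               frac (pairNum (t i) (y i)) (pairDen (t i) (y i))
  pair i = trans (cong₂ (λ b c → signPow (not b) (suc n ℕ.+ 2 ℕ.* (2 ℕ.* i)) * signPow c (suc n ℕ.+ 2 ℕ.* suc (2 ℕ.* i)))
                        (t-double i) (trans (cong not (t-suc-double i)) (not-involutive (t i))))
           (trans (cong₂ (λ a c → signPow (not (t i)) a * signPow (t i) c) (even-index n i) (odd-index n i))
                  (signPow-pair (t i) (y>0 i)))

y*y≤[2+y]*[4+y] : ∀ y → y ℕ.* y ≤ (2 ℕ.+ y) ℕ.* (4 ℕ.+ y)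
y*y≤[2+y]*[4+y] y = ℕP.*-mono-≤ (ℕP.m≤n+m y 2) (ℕP.m≤n+m y 4)

[2+y]*y≤y*[4+y] : ∀ y → (2 ℕ.+ y) ℕ.* y ≤ y ℕ.* (4 ℕ.+ y)
[2+y]*y≤y*[4+y] y = ℕP.≤-trans (ℕP.≤-reflexive (ℕP.*-comm (2 ℕ.+ y) y))
                                 (ℕP.*-monoʳ-≤ y (ℕP.+-monoˡ-≤ y (s≤s (s≤s z≤n))))

pairNum-bound : ∀ b y → pairNum b y ℕ.* y ≤ pairDen b y ℕ.* (4 ℕ.+ y)
pairNum-bound true  y = subst₂ (λ a c → a ℕ.* y ≤ c ℕ.* (4 ℕ.+ y))
  (sym (ℕP.*-identityʳ y)) (sym (ℕP.*-identityˡ (2 ℕ.+ y))) (y*y≤[2+y]*[4+y] y)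
pairNum-bound false y = subst₂ (λ a c → a ℕ.* y ≤ c ℕ.* (4 ℕ.+ y))
  (sym (ℕP.*-identityˡ (2 ℕ.+ y))) (sym (ℕP.*-identityʳ y)) ([2+y]*y≤y*[4+y] y)

pairDen-bound : ∀ b y → pairDen b y ℕ.* y ≤ pairNum b y ℕ.* (4 ℕ.+ y)
pairDen-bound true  y = subst₂ (λ a c → a ℕ.* y ≤ c ℕ.* (4 ℕ.+ y))
  (sym (ℕP.*-identityˡ (2 ℕ.+ y))) (sym (ℕP.*-identityʳ y)) ([2+y]*y≤y*[4+y] y)
pairDen-bound false y = subst₂ (λ a c → a ℕ.* y ≤ c ℕ.* (4 ℕ.+ y))
  (sym (ℕP.*-identityʳ y)) (sym (ℕP.*-identityˡ (2 ℕ.+ y))) (y*y≤[2+y]*[4+y] y)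

remainder-bounds : ∀ K x →
  remNum K x ℕ.* x ≤ remDen K x ℕ.* (4 ℕ.* K ℕ.+ x) ×
  remDen K x ℕ.* x ≤ remNum K x ℕ.* (4 ℕ.* K ℕ.+ x)
remainder-bounds K x =
  prodℕ-ratio-bound _ _ y num-step K , prodℕ-ratio-bound _ _ y den-step K
  where
  y : ℕ → ℕ
  y i = 4 ℕ.* i ℕ.+ x
  shift : ∀ i x → 4 ℕ.+ (4 ℕ.* i ℕ.+ x) ≡ 4 ℕ.* suc i ℕ.+ x
  shift = solve-∀
  next : ∀ i → 4 ℕ.+ y i ≡ y (suc i)
  next i = shift i x
  num-step : ∀ i → pairNum (t i) (y i) ℕ.* y i ≤ pairDen (t i) (y i) ℕ.* y (suc i)
  num-step i = subst (λ z → pairNum (t i) (y i) ℕ.* y i ≤ pairDen (t i) (y i) ℕ.* z) (next i) (pairNum-bound (t i) (y i))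
  den-step : ∀ i → pairDen (t i) (y i) ℕ.* y i ≤ pairNum (t i) (y i) ℕ.* y (suc i)
  den-step i = subst (λ z → pairDen (t i) (y i) ℕ.* y i ≤ pairNum (t i) (y i) ℕ.* z) (next i) (pairDen-bound (t i) (y i))

partial≡frac : ∀ k n → partial (2 ℕ.+ k) n ≡
  frac (rhsNum (2 ℕ.^ suc k) ℕ.* remNum (2 ℕ.^ k) (suc n)) (rhsDen (2 ℕ.^ suc k) ℕ.* remDen (2 ℕ.^ k) (suc n))
partial≡frac k n = begin
  partial (2 ℕ.+ k) n                           ≡⟨ partial≡rhs*remainder k n ⟩
  rhs (2 ℕ.+ k) * remainder (2 ℕ.^ suc k) n     ≡⟨ cong₂ _*_ (rhs≡frac k) (remainder≡frac (2 ℕ.^ k) n) ⟩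
  frac (rhsNum M) (rhsDen M) * frac (remNum K (suc n)) (remDen K (suc n))
    ≡⟨ frac-* (rhsDen-pos M) (remDen-pos K (s≤s z≤n)) ⟩
  frac (rhsNum M ℕ.* remNum K (suc n)) (rhsDen M ℕ.* remDen K (suc n)) ∎
  where
  open ≡-Reasoning
  M K : ℕ
  M = 2 ℕ.^ suc k
  K = 2 ℕ.^ k

mainTheorem1 : (m : ℕ) → 1 <ℕ m →
    (rhs m ≢ 0ℚ) ×
    ((ε : ℚ) → 0ℚ < ε → ∃[ N ] ((n : ℕ) → N ≤ n → ∣ partial m n - rhs m ∣ < ε))
mainTheorem1 (suc zero)    (s≤s ())
mainTheorem1 (suc (suc k)) _        = rhs≢0 , converges
  where
  M K : ℕ
  M = 2 ℕ.^ suc k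
  K = 2 ℕ.^ k
  rhs≢0 : rhs (2 ℕ.+ k) ≢ 0ℚ
  rhs≢0 = frac≢0 (rhsNum-pos M) (rhsDen-pos M) ∘ trans (sym (rhs≡frac k))
  converges : (ε : ℚ) → 0ℚ < ε → ∃[ N ] ((n : ℕ) → N ≤ n → ∣ partial (2 ℕ.+ k) n - rhs (2 ℕ.+ k) ∣ < ε)
  converges ε ε>0 with positive⇒frac ε>0
  ... | e , d , refl = 4 ℕ.* K ℕ.* (rhsNum M ℕ.* suc d) , λ n N≤n →
    let x>0 = s≤s z≤n
        (num-bound , den-bound) = remainder-bounds K (suc n)
    in subst₂ (λ P L → ∣ P - L ∣ < frac (suc e) (suc d)) (sym (partial≡frac k n)) (sym (rhs≡frac k))
         (frac-close e d (rhsDen-pos M) (remNum-pos K x>0) (remDen-pos K x>0) num-bound den-bound (s≤s N≤n))
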